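{- The relation $\mathcal{L}^{\omega}$ on closed $\mu$TCL terms is reflexive: $\mathcal{L}^\omega_\tau(t,t)$ for every type $\tau$ and every closed term $t$ of type $\tau$.
   Context: Types of $\mu$TCL: closed type expressions, modulo $\alpha$-equivalence, of the grammar $\tau::=\alpha\mid \tau_1\boxplus\tau_2\mid\tau_1\boxtimes\tau_2\mid \tau_1\Rightarrow\tau_2\mid \mu\alpha.\tau$. Closed terms are built from: constants $S_{\tau_1,\tau_2,\tau_3}\colon(\tau_1\Rightarrow\tau_2\Rightarrow\tau_3)\Rightarrow(\tau_1\Rightarrow\tau_2)\Rightarrow\tau_1\Rightarrow\tau_3$, $K_{\tau_1,\tau_2}\colon \tau_1\Rightarrow\tau_2\Rightarrow\tau_1$, $I_\tau\colon\tau\Rightarrow\tau$; operations $S'\colon(\tau_1\Rightarrow\tau_2\Rightarrow\tau_3)\to((\tau_1\Rightarrow\tau_2)\Rightarrow\tau_1\Rightarrow\tau_3)$, $S''\colon (\tau_1\Rightarrow\tau_2\Rightarrow\tau_3)\times(\tau_1\Rightarrow\tau_2)\to(\tau_1\Rightarrow\tau_3)$, $K'\colon\tau_1\to(\tau_2\Rightarrow\tau_1)$, application $t\,s$ of type $\tau_2$ for $t\colon\tau_1\Rightarrow\tau_2$, $s\colon\tau_1$, $\mathsf{inl}\colon\tau_1\to\tau_1\boxplus\tau_2$, $\mathsf{inr}\colon\tau_2\to\tau_1\boxplus\tau_2$, $\mathsf{case}\colon(\tau_1\boxplus\tau_2)\times(\tau_1\Rightarrow\tau_3)\times(\tau_2\Rightarrow\tau_3)\to\tau_3$,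 $\mathsf{pair}\colon\tau_1\times\tau_2\to\tau_1\boxtimes\tau_2$, $\mathsf{fst}\colon\tau_1\boxtimes\tau_2\to\tau_1$, $\mathsf{snd}\colon\tau_1\boxtimes\tau_2\to\tau_2$, $\mathsf{fold}_\tau\colon\tau[\mu\alpha.\tau/\alpha]\to\mu\alpha.\tau$, $\mathsf{unfold}_\tau\colon\mu\alpha.\tau\to\tau[\mu\alpha.\tau/\alpha]$. Transitions are exactly those derivable by: $S\xrightarrow{e}S'(e)$; $S'(t)\xrightarrow{e}S''(t,e)$; $S''(t,s)\xrightarrow{e}(t\,e)(s\,e)$; $K\xrightarrow{e}K'(e)$; $K'(t)\xrightarrow{e}t$; $I\xrightarrow{e}e$; $t\to t'\Rightarrow t\,s\to t'\,s$; $t\xrightarrow{s}t'\Rightarrow t\,s\to t'$; $\mathsf{inl}(t)\xrightarrow{\boxplus_1}t$; $\mathsf{inr}(t)\xrightarrow{\boxplus_2}t$; $t\to t'\Rightarrow\mathsf{case}(t,s,r)\to\mathsf{case}(t',s,r)$; $t\xrightarrow{\boxplus_1}t'\Rightarrow\mathsf{case}(t,s,r)\to s\,t'$; $t\xrightarrow{\boxplus_2}t'\Rightarrow\mathsf{case}(t,s,r)\to r\,t'$; $\mathsf{pair}(t,s)\xrightarrow{\boxtimes_1}t$; $\mathsf{pair}(t,s)\xrightarrow{\boxtimes_2}s$; $t\to t'\Rightarrow\mathsf{fst}(t)\to\mathsf{fst}(t'),\ \mathsf{snd}(t)\to\mathsf{snd}(t')$; $t\xrightarrow{\boxtimes_1}t'\Rightarrow\mathsf{fst}(t)\to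 t'$; $t\xrightarrow{\boxtimes_2}t'\Rightarrow\mathsf{snd}(t)\to t'$; $\mathsf{fold}(t)\xrightarrow{\mu}t$; $t\to t'\Rightarrow\mathsf{unfold}(t)\to\mathsf{unfold}(t')$; $t\xrightarrow{\mu}t'\Rightarrow\mathsf{unfold}(t)\to t'$. $\Rightarrow$ is the reflexive transitive closure of $\to$, and $t\overset{l}{\Rightarrow}s$ iff $t\Rightarrow t'\xrightarrow{l}s$ for some $t'$. For type-indexed relations $Q,R$: $\mathcal{E}(R)_\tau=\{(t,s)\mid t\to t'\implies\exists s'.\,s\Rightarrow s'\wedge R_\tau(t',s')\}$; $\mathcal{V}_{\tau_1\boxplus\tau_2}(Q,R)=\{(t,s)\mid$ for $i=1,2$: $t\xrightarrow{\boxplus_i}t'\implies\exists s'.\,s\overset{\boxplus_i}{\Rightarrow}s'\wedge R_{\tau_i}(t',s')\}$; $\mathcal{V}_{\tau_1\boxtimes\tau_2}(Q,R)=\{(t,s)\mid t\xrightarrow{\boxtimes_1}t_1\wedge t\xrightarrow{\boxtimes_2}t_2\implies \exists s_1,s_2.\,s\overset{\boxtimes_1}{\Rightarrow}s_1\wedge s\overset{\boxtimes_2}{\Rightarrow}s_2\wedge R_{\tau_1}(t_1,s_1)\wedge R_{\tau_2}(t_2,s_2)\}$; $\mathcal{V}_{\tau_1\Rightarrow\tau_2}(Q,R)=\{(t,s)\mid\forall e_1,e_2.\,Q_{\tau_1}(e_1,e_2)\wedge t\xrightarrow{e_1}t'\implies\exists s'.\,s\overset{e_2}{\Rightarrow}s'\wedge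 R_{\tau_2}(t',s')\}$; $\mathcal{V}_{\mu\alpha.\tau}(Q,R)=\{(t,s)\mid t\xrightarrow{\mu}t'\implies\exists s'.\,s\overset{\mu}{\Rightarrow}s'\wedge R_{\tau[\mu\alpha.\tau/\alpha]}(t',s')\}$. $\mathcal{L}^0$ is the full relation, $\mathcal{L}^{n+1}=\mathcal{L}^n\cap\mathcal{E}(\mathcal{L}^n)\cap\mathcal{V}(\mathcal{L}^n,\mathcal{L}^n)$, $\mathcal{L}^\omega=\bigcap_{n<\omega}\mathcal{L}^n$. -}

module Defs where

open import Data.Nat using (ℕ; zero; suc)
open import Data.Fin using (Fin; zero; suc)
open import Data.Unit using (⊤)
open import Data.Product using (Σ; ∃; _×_; _,_)
open import Relation.Binary.Construct.Closure.ReflexiveTransitive using (Star)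

-- Types: de Bruijn representation (so α-equivalence is syntactic
-- equality).  Ty n = type expressions with at most n free variables;
-- closed types are Ty 0.

infixr 7 _⇒_
infixr 6 _⊠_
infixr 5 _⊞_

data Ty (n : ℕ) : Set where
  var  : Fin n → Ty n
  _⊞_  : Ty n → Ty n → Ty n
  _⊠_  : Ty n → Ty n → Ty n
  _⇒_  : Ty n → Ty n → Ty n
  μ    : Ty (suc n) → Ty n

ext : ∀ {m n} → (Fin m → Fin n) → Fin (suc m) → Fin (suc n)
ext ρ zero    = zero
ext ρ (suc i) = suc (ρ i)

rename : ∀ {m n} → (Fin m → Fin n) → Ty m → Ty n
rename ρ (var i)   = var (ρ i)
rename ρ (a ⊞ b)   = rename ρ a ⊞ rename ρ b
rename ρ (a ⊠ b)   = rename ρ a ⊠ rename ρ b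
rename ρ (a ⇒ b)   = rename ρ a ⇒ rename ρ b
rename ρ (μ a)     = μ (rename (ext ρ) a)

exts : ∀ {m n} → (Fin m → Ty n) → Fin (suc m) → Ty (suc n)
exts σ zero    = var zero
exts σ (suc i) = rename suc (σ i)

subst : ∀ {m n} → (Fin m → Ty n) → Ty m → Ty n
subst σ (var i)   = σ i
subst σ (a ⊞ b)   = subst σ a ⊞ subst σ b
subst σ (a ⊠ b)   = subst σ a ⊠ subst σ b
subst σ (a ⇒ b)   = subst σ a ⇒ subst σ b
subst σ (μ a)     = μ (subst (exts σ) a)

single : ∀ {n} → Ty n → Fin (suc n) → Ty n
single ρ zero    = ρ
single ρ (suc i) = var i

_[_] : ∀ {n} → Ty (suc n) → Ty n → Ty n
τ [ ρ ] = subst (single ρ) τ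

unf : Ty 1 → Ty 0
unf τ = τ [ μ τ ]

CTy : Set
CTy = Ty 0

infixl 9 _·_

data Tm : CTy → Set where
  S    : ∀ {τ₁ τ₂ τ₃} → Tm ((τ₁ ⇒ τ₂ ⇒ τ₃) ⇒ (τ₁ ⇒ τ₂) ⇒ τ₁ ⇒ τ₃)
  K    : ∀ {τ₁ τ₂} → Tm (τ₁ ⇒ τ₂ ⇒ τ₁)
  I    : ∀ {τ} → Tm (τ ⇒ τ)
  S′   : ∀ {τ₁ τ₂ τ₃} → Tm (τ₁ ⇒ τ₂ ⇒ τ₃) → Tm ((τ₁ ⇒ τ₂) ⇒ τ₁ ⇒ τ₃)
  S″   : ∀ {τ₁ τ₂ τ₃} → Tm (τ₁ ⇒ τ₂ ⇒ τ₃) → Tm (τ₁ ⇒ τ₂) → Tm (τ₁ ⇒ τ₃)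
  K′   : ∀ {τ₁ τ₂} → Tm τ₁ → Tm (τ₂ ⇒ τ₁)
  _·_  : ∀ {τ₁ τ₂} → Tm (τ₁ ⇒ τ₂) → Tm τ₁ → Tm τ₂
  inl  : ∀ {τ₁ τ₂} → Tm τ₁ → Tm (τ₁ ⊞ τ₂)
  inr  : ∀ {τ₁ τ₂} → Tm τ₂ → Tm (τ₁ ⊞ τ₂)
  case : ∀ {τ₁ τ₂ τ₃} → Tm (τ₁ ⊞ τ₂) → Tm (τ₁ ⇒ τ₃) → Tm (τ₂ ⇒ τ₃) → Tm τ₃
  pair : ∀ {τ₁ τ₂} → Tm τ₁ → Tm τ₂ → Tm (τ₁ ⊠ τ₂)
  fst  : ∀ {τ₁ τ₂} → Tm (τ₁ ⊠ τ₂) → Tm τ₁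
  snd  : ∀ {τ₁ τ₂} → Tm (τ₁ ⊠ τ₂) → Tm τ₂
  fold   : ∀ {τ} → Tm (unf τ) → Tm (μ τ)
  unfold : ∀ {τ} → Tm (μ τ) → Tm (unf τ)

data Label : CTy → CTy → Set where
  lapp : ∀ {τ₁ τ₂} → Tm τ₁ → Label (τ₁ ⇒ τ₂) τ₂
  l⊞₁  : ∀ {τ₁ τ₂} → Label (τ₁ ⊞ τ₂) τ₁
  l⊞₂  : ∀ {τ₁ τ₂} → Label (τ₁ ⊞ τ₂) τ₂
  l⊠₁  : ∀ {τ₁ τ₂} → Label (τ₁ ⊠ τ₂) τ₁
  l⊠₂  : ∀ {τ₁ τ₂} → Label (τ₁ ⊠ τ₂) τ₂
  lμ   : ∀ {τ} → Label (μ τ) (unf τ)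

data _─[_]→_ : ∀ {τ σ} → Tm τ → Label τ σ → Tm σ → Set where
  S-e   : ∀ {τ₁ τ₂ τ₃} {e : Tm (τ₁ ⇒ τ₂ ⇒ τ₃)} → S ─[ lapp e ]→ S′ e
  S′-e  : ∀ {τ₁ τ₂ τ₃} {t : Tm (τ₁ ⇒ τ₂ ⇒ τ₃)} {e : Tm (τ₁ ⇒ τ₂)} → S′ t ─[ lapp e ]→ S″ t e
  S″-e  : ∀ {τ₁ τ₂ τ₃} {t : Tm (τ₁ ⇒ τ₂ ⇒ τ₃)} {s : Tm (τ₁ ⇒ τ₂)} {e : Tm τ₁} →
          S″ t s ─[ lapp e ]→ ((t · e) · (s · e))
  K-e   : ∀ {τ₁ τ₂} {e : Tm τ₁} → K {τ₁} {τ₂} ─[ lapp e ]→ K′ e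
  K′-e  : ∀ {τ₁ τ₂} {t : Tm τ₁} {e : Tm τ₂} → K′ t ─[ lapp e ]→ t
  I-e   : ∀ {τ} {e : Tm τ} → I ─[ lapp e ]→ e
  inl-l : ∀ {τ₁ τ₂} {t : Tm τ₁} → inl {τ₁} {τ₂} t ─[ l⊞₁ ]→ t
  inr-l : ∀ {τ₁ τ₂} {t : Tm τ₂} → inr {τ₁} {τ₂} t ─[ l⊞₂ ]→ t
  pair₁ : ∀ {τ₁ τ₂} {t : Tm τ₁} {s : Tm τ₂} → pair t s ─[ l⊠₁ ]→ t
  pair₂ : ∀ {τ₁ τ₂} {t : Tm τ₁} {s : Tm τ₂} → pair t s ─[ l⊠₂ ]→ s
  fold-l : ∀ {τ} {t : Tm (unf τ)} → fold {τ} t ─[ lμ ]→ t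

data _⟶_ : ∀ {τ} → Tm τ → Tm τ → Set where
  app-l   : ∀ {τ₁ τ₂} {t t′ : Tm (τ₁ ⇒ τ₂)} {s : Tm τ₁} → t ⟶ t′ → (t · s) ⟶ (t′ · s)
  app-β   : ∀ {τ₁ τ₂} {t : Tm (τ₁ ⇒ τ₂)} {s : Tm τ₁} {t′ : Tm τ₂} → t ─[ lapp s ]→ t′ → (t · s) ⟶ t′
  case-c  : ∀ {τ₁ τ₂ τ₃} {t t′ : Tm (τ₁ ⊞ τ₂)} {s : Tm (τ₁ ⇒ τ₃)} {r : Tm (τ₂ ⇒ τ₃)} →
            t ⟶ t′ → case t s r ⟶ case t′ s r
  case-₁  : ∀ {τ₁ τ₂ τ₃} {t : Tm (τ₁ ⊞ τ₂)} {t′ : Tm τ₁} {s : Tm (τ₁ ⇒ τ₃)} {r : Tm (τ₂ ⇒ τ₃)} →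
            t ─[ l⊞₁ ]→ t′ → case t s r ⟶ (s · t′)
  case-₂  : ∀ {τ₁ τ₂ τ₃} {t : Tm (τ₁ ⊞ τ₂)} {t′ : Tm τ₂} {s : Tm (τ₁ ⇒ τ₃)} {r : Tm (τ₂ ⇒ τ₃)} →
            t ─[ l⊞₂ ]→ t′ → case t s r ⟶ (r · t′)
  fst-c   : ∀ {τ₁ τ₂} {t t′ : Tm (τ₁ ⊠ τ₂)} → t ⟶ t′ → fst t ⟶ fst t′
  snd-c   : ∀ {τ₁ τ₂} {t t′ : Tm (τ₁ ⊠ τ₂)} → t ⟶ t′ → snd t ⟶ snd t′
  fst-β   : ∀ {τ₁ τ₂} {t : Tm (τ₁ ⊠ τ₂)} {t′ : Tm τ₁} → t ─[ l⊠₁ ]→ t′ → fst t ⟶ t′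
  snd-β   : ∀ {τ₁ τ₂} {t : Tm (τ₁ ⊠ τ₂)} {t′ : Tm τ₂} → t ─[ l⊠₂ ]→ t′ → snd t ⟶ t′
  unfold-c : ∀ {τ} {t t′ : Tm (μ τ)} → t ⟶ t′ → unfold t ⟶ unfold t′
  unfold-β : ∀ {τ} {t : Tm (μ τ)} {t′ : Tm (unf τ)} → t ─[ lμ ]→ t′ → unfold t ⟶ t′

_⟹_ : ∀ {τ} → Tm τ → Tm τ → Set
_⟹_ = Star _⟶_

_═[_]⇒_ : ∀ {τ σ} → Tm τ → Label τ σ → Tm σ → Set
t ═[ l ]⇒ s = ∃ λ t′ → (t ⟹ t′) × (t′ ─[ l ]→ s)

TRel : Set₁
TRel = (τ : CTy) → Tm τ → Tm τ → Set

_∩_ : TRel → TRel → TRel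
(Q ∩ R) τ t s = Q τ t s × R τ t s

𝓔 : TRel → TRel
𝓔 R τ t s = ∀ t′ → t ⟶ t′ → ∃ λ s′ → (s ⟹ s′) × R τ t′ s′

𝓥 : TRel → TRel → TRel
𝓥 Q R (var ())
𝓥 Q R (τ₁ ⊞ τ₂) t s =
  (∀ t′ → t ─[ l⊞₁ ]→ t′ → ∃ λ s′ → (s ═[ l⊞₁ ]⇒ s′) × R τ₁ t′ s′) ×
  (∀ t′ → t ─[ l⊞₂ ]→ t′ → ∃ λ s′ → (s ═[ l⊞₂ ]⇒ s′) × R τ₂ t′ s′)
𝓥 Q R (τ₁ ⊠ τ₂) t s =
  ∀ t₁ t₂ → t ─[ l⊠₁ ]→ t₁ → t ─[ l⊠₂ ]→ t₂ →
  ∃ λ s₁ → ∃ λ s₂ → (s ═[ l⊠₁ ]⇒ s₁) × (s ═[ l⊠₂ ]⇒ s₂) × R τ₁ t₁ s₁ × R τ₂ t₂ s₂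
𝓥 Q R (τ₁ ⇒ τ₂) t s =
  ∀ (e₁ e₂ : Tm τ₁) t′ → Q τ₁ e₁ e₂ → t ─[ lapp e₁ ]→ t′ →
  ∃ λ s′ → (s ═[ lapp e₂ ]⇒ s′) × R τ₂ t′ s′
𝓥 Q R (μ τ) t s =
  ∀ t′ → t ─[ lμ ]→ t′ → ∃ λ s′ → (s ═[ lμ ]⇒ s′) × R (unf τ) t′ s′

𝓛 : ℕ → TRel
𝓛 zero    τ t s = ⊤
𝓛 (suc n) = 𝓛 n ∩ (𝓔 (𝓛 n) ∩ 𝓥 (𝓛 n) (𝓛 n))

𝓛ω : TRel
𝓛ω τ t s = ∀ n → 𝓛 n τ t s

-- Reflexivity is the special case t = s of the fundamental property: each 𝓛ⁿ
-- is closed under all term formers, i.e. contains its own compatible closure. At level n + 1 the three conjuncts are checked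
-- for one term former at a time; whenever a step or label of the left term
-- produces a new pair of terms (such as (t · e₁) · (u · e₁) and
-- (s · e₂) · (v · e₂) after S″), that pair lies in the compatible closure of
-- 𝓛ⁿ, so the induction hypothesis applies.
module Submission where

open import Defs
open import Data.Nat using (ℕ; zero; suc)
open import Data.Unit using (⊤; tt)
open import Data.Empty using (⊥; ⊥-elim)
open import Data.Product using (∃; _,_; proj₁; proj₂)
open import Relation.Binary.Construct.Closure.ReflexiveTransitive using (ε; _◅_; _◅◅_; gmap)

data Compatible (R : TRel) : TRel where
  base   : ∀ {τ t s} → R τ t s → Compatible R τ t s
  S      : ∀ {τ₁ τ₂ τ₃} → Compatible R _ (S {τ₁} {τ₂} {τ₃}) S
  K      : ∀ {τ₁ τ₂} → Compatible R _ (K {τ₁} {τ₂}) K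
  I      : ∀ {τ} → Compatible R _ (I {τ}) I
  S′     : ∀ {τ₁ τ₂ τ₃} {t s : Tm (τ₁ ⇒ τ₂ ⇒ τ₃)} →
           Compatible R _ t s → Compatible R _ (S′ t) (S′ s)
  S″     : ∀ {τ₁ τ₂ τ₃} {t s : Tm (τ₁ ⇒ τ₂ ⇒ τ₃)} {u v : Tm (τ₁ ⇒ τ₂)} →
           Compatible R _ t s → Compatible R _ u v → Compatible R _ (S″ t u) (S″ s v)
  K′     : ∀ {τ₁ τ₂} {t s : Tm τ₁} →
           Compatible R _ t s → Compatible R (τ₂ ⇒ τ₁) (K′ t) (K′ s)
  _·_    : ∀ {τ₁ τ₂} {t s : Tm (τ₁ ⇒ τ₂)} {u v : Tm τ₁} →
           Compatible R _ t s → Compatible R _ u v → Compatible R _ (t · u) (s · v)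
  inl    : ∀ {τ₁ τ₂} {t s : Tm τ₁} →
           Compatible R _ t s → Compatible R (τ₁ ⊞ τ₂) (inl t) (inl s)
  inr    : ∀ {τ₁ τ₂} {t s : Tm τ₂} →
           Compatible R _ t s → Compatible R (τ₁ ⊞ τ₂) (inr t) (inr s)
  case   : ∀ {τ₁ τ₂ τ₃} {t s : Tm (τ₁ ⊞ τ₂)} {f f′ : Tm (τ₁ ⇒ τ₃)} {g g′ : Tm (τ₂ ⇒ τ₃)} →
           Compatible R _ t s → Compatible R _ f f′ → Compatible R _ g g′ →
           Compatible R _ (case t f g) (case s f′ g′)
  pair   : ∀ {τ₁ τ₂} {t s : Tm τ₁} {u v : Tm τ₂} →
           Compatible R _ t s → Compatible R _ u v → Compatible R _ (pair t u) (pair s v)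
  fst    : ∀ {τ₁ τ₂} {t s : Tm (τ₁ ⊠ τ₂)} → Compatible R _ t s → Compatible R _ (fst t) (fst s)
  snd    : ∀ {τ₁ τ₂} {t s : Tm (τ₁ ⊠ τ₂)} → Compatible R _ t s → Compatible R _ (snd t) (snd s)
  fold   : ∀ {τ} {t s : Tm (unf τ)} → Compatible R _ t s → Compatible R (μ τ) (fold t) (fold s)
  unfold : ∀ {τ} {t s : Tm (μ τ)} → Compatible R _ t s → Compatible R (unf τ) (unfold t) (unfold s)

Compatible-refl : ∀ {R τ} (t : Tm τ) → Compatible R τ t t
Compatible-refl S            = S
Compatible-refl K            = K
Compatible-refl I            = I
Compatible-refl (S′ t)       = S′ (Compatible-refl t)
Compatible-refl (S″ t u)     = S″ (Compatible-refl t) (Compatible-refl u)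
Compatible-refl (K′ t)       = K′ (Compatible-refl t)
Compatible-refl (t · u)      = Compatible-refl t · Compatible-refl u
Compatible-refl (inl t)      = inl (Compatible-refl t)
Compatible-refl (inr t)      = inr (Compatible-refl t)
Compatible-refl (case t f g) = case (Compatible-refl t) (Compatible-refl f) (Compatible-refl g)
Compatible-refl (pair t u)   = pair (Compatible-refl t) (Compatible-refl u)
Compatible-refl (fst t)      = fst (Compatible-refl t)
Compatible-refl (snd t)      = snd (Compatible-refl t)
Compatible-refl (fold t)     = fold (Compatible-refl t)
Compatible-refl (unfold t)   = unfold (Compatible-refl t)

IsValue : ∀ {τ} → Tm τ → Set
IsValue (_ · _)      = ⊥
IsValue (case _ _ _) = ⊥
IsValue (fst _)      = ⊥
IsValue (snd _)      = ⊥
IsValue (unfold _)   = ⊥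
IsValue _            = ⊤

labelled⇒value : ∀ {τ σ} {t : Tm τ} {l : Label τ σ} {t′ : Tm σ} → t ─[ l ]→ t′ → IsValue t
labelled⇒value S-e    = tt
labelled⇒value S′-e   = tt
labelled⇒value S″-e   = tt
labelled⇒value K-e    = tt
labelled⇒value K′-e   = tt
labelled⇒value I-e    = tt
labelled⇒value inl-l  = tt
labelled⇒value inr-l  = tt
labelled⇒value pair₁  = tt
labelled⇒value pair₂  = tt
labelled⇒value fold-l = tt

value⇒irreducible : ∀ {τ} {t t′ : Tm τ} → IsValue t → t ⟶ t′ → ⊥
value⇒irreducible () (app-l _)
value⇒irreducible () (app-β _)
value⇒irreducible () (case-c _)
value⇒irreducible () (case-₁ _)
value⇒irreducible () (case-₂ _)
value⇒irreducible () (fst-c _)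
value⇒irreducible () (snd-c _)
value⇒irreducible () (fst-β _)
value⇒irreducible () (snd-β _)
value⇒irreducible () (unfold-c _)
value⇒irreducible () (unfold-β _)

𝓔-value : ∀ {R τ} {t s : Tm τ} → IsValue t → 𝓔 R τ t s
𝓔-value v t′ step = ⊥-elim (value⇒irreducible v step)

𝓥-nonvalue : ∀ {Q R} τ {t s : Tm τ} → (IsValue t → ⊥) → 𝓥 Q R τ t s
𝓥-nonvalue (var ())
𝓥-nonvalue (τ₁ ⊞ τ₂) ¬v = (λ _ d → ⊥-elim (¬v (labelled⇒value d)))
                        , (λ _ d → ⊥-elim (¬v (labelled⇒value d)))
𝓥-nonvalue (τ₁ ⊠ τ₂) ¬v = λ _ _ d _ → ⊥-elim (¬v (labelled⇒value d))
𝓥-nonvalue (τ₁ ⇒ τ₂) ¬v = λ _ _ _ _ d → ⊥-elim (¬v (labelled⇒value d))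
𝓥-nonvalue (μ τ)     ¬v = λ _ d → ⊥-elim (¬v (labelled⇒value d))

-- 𝓥 at a product type only constrains terms having both projections, so a
-- single projection must be completed to a pair of them before 𝓥 is applied.
l⊠₁⇒l⊠₂ : ∀ {τ₁ τ₂} {t : Tm (τ₁ ⊠ τ₂)} {t₁ : Tm τ₁} → t ─[ l⊠₁ ]→ t₁ → ∃ λ t₂ → t ─[ l⊠₂ ]→ t₂
l⊠₁⇒l⊠₂ pair₁ = _ , pair₂

l⊠₂⇒l⊠₁ : ∀ {τ₁ τ₂} {t : Tm (τ₁ ⊠ τ₂)} {t₂ : Tm τ₂} → t ─[ l⊠₂ ]→ t₂ → ∃ λ t₁ → t ─[ l⊠₁ ]→ t₁
l⊠₂⇒l⊠₁ pair₂ = _ , pair₁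

⟹-eliminate : ∀ {τ σ ρ} {l : Label τ σ} {s : Tm τ} {s′ : Tm σ}
                (F : Tm τ → Tm ρ) {G : Tm σ → Tm ρ} →
                (∀ {x y} → x ⟶ y → F x ⟶ F y) →
                (∀ {x y} → x ─[ l ]→ y → F x ⟶ G y) →
                s ═[ l ]⇒ s′ → F s ⟹ G s′
⟹-eliminate F congruence β (_ , steps , d) = gmap F congruence steps ◅◅ β d ◅ ε

module SuccessorLevel (n : ℕ) (𝓛ⁿ-compatible : ∀ {τ t s} → Compatible (𝓛 n) τ t s → 𝓛 n τ t s) where

  private
    L  = 𝓛 n
    L⁺ = 𝓛 (suc n)

  lower : ∀ {τ t s} → L⁺ τ t s → Compatible L τ t s
  lower p = base (proj₁ p)

  𝓔-part : ∀ {τ t s} → L⁺ τ t s → 𝓔 L τ t s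
  𝓔-part p = proj₁ (proj₂ p)

  𝓥-part : ∀ {τ t s} → L⁺ τ t s → 𝓥 L L τ t s
  𝓥-part p = proj₂ (proj₂ p)

  value-compat : ∀ {τ t s} → IsValue t → Compatible L τ t s → 𝓥 L L τ t s → L⁺ τ t s
  value-compat v c w = 𝓛ⁿ-compatible c , 𝓔-value {L} v , w

  nonvalue-compat : ∀ τ {t s} → (IsValue t → ⊥) → Compatible L τ t s → 𝓔 L τ t s → L⁺ τ t s
  nonvalue-compat τ ¬v c e = 𝓛ⁿ-compatible c , e , 𝓥-nonvalue τ ¬v

  S-compat : ∀ {τ₁ τ₂ τ₃} → L⁺ _ (S {τ₁} {τ₂} {τ₃}) S
  S-compat = value-compat tt S λ { _ e₂ _ q S-e → S′ e₂ , (S , ε , S-e) , 𝓛ⁿ-compatible (S′ (base q)) }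

  K-compat : ∀ {τ₁ τ₂} → L⁺ _ (K {τ₁} {τ₂}) K
  K-compat = value-compat tt K λ { _ e₂ _ q K-e → K′ e₂ , (K , ε , K-e) , 𝓛ⁿ-compatible (K′ (base q)) }

  I-compat : ∀ {τ} → L⁺ _ (I {τ}) I
  I-compat = value-compat tt I λ { _ e₂ _ q I-e → e₂ , (I , ε , I-e) , q }

  S′-compat : ∀ {τ₁ τ₂ τ₃} {t s : Tm (τ₁ ⇒ τ₂ ⇒ τ₃)} → L⁺ _ t s → L⁺ _ (S′ t) (S′ s)
  S′-compat {s = s} p = value-compat tt (S′ (lower p))
    λ { _ e₂ _ q S′-e → S″ s e₂ , (S′ s , ε , S′-e) , 𝓛ⁿ-compatible (S″ (lower p) (base q)) }

  S″-compat : ∀ {τ₁ τ₂ τ₃} {t s : Tm (τ₁ ⇒ τ₂ ⇒ τ₃)} {u v : Tm (τ₁ ⇒ τ₂)} →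
              L⁺ _ t s → L⁺ _ u v → L⁺ _ (S″ t u) (S″ s v)
  S″-compat {s = s} {v = v} p p′ = value-compat tt (S″ (lower p) (lower p′))
    λ { _ e₂ _ q S″-e → (s · e₂) · (v · e₂) , (S″ s v , ε , S″-e)
                      , 𝓛ⁿ-compatible ((lower p · base q) · (lower p′ · base q)) }

  K′-compat : ∀ {τ₁ τ₂} {t s : Tm τ₁} → L⁺ _ t s → L⁺ (τ₂ ⇒ τ₁) (K′ t) (K′ s)
  K′-compat {s = s} p = value-compat tt (K′ (lower p))
    λ { _ _ _ _ K′-e → s , (K′ s , ε , K′-e) , proj₁ p }

  inl-compat : ∀ {τ₁ τ₂} {t s : Tm τ₁} → L⁺ _ t s → L⁺ (τ₁ ⊞ τ₂) (inl t) (inl s)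
  inl-compat {s = s} p = value-compat tt (inl (lower p))
    ((λ { _ inl-l → s , (inl s , ε , inl-l) , proj₁ p }) , λ { _ () })

  inr-compat : ∀ {τ₁ τ₂} {t s : Tm τ₂} → L⁺ _ t s → L⁺ (τ₁ ⊞ τ₂) (inr t) (inr s)
  inr-compat {s = s} p = value-compat tt (inr (lower p))
    ((λ { _ () }) , λ { _ inr-l → s , (inr s , ε , inr-l) , proj₁ p })

  pair-compat : ∀ {τ₁ τ₂} {t s : Tm τ₁} {u v : Tm τ₂} →
                L⁺ _ t s → L⁺ _ u v → L⁺ _ (pair t u) (pair s v)
  pair-compat {s = s} {v = v} p p′ = value-compat tt (pair (lower p) (lower p′))
    λ { _ _ pair₁ pair₂ → s , v , (pair s v , ε , pair₁) , (pair s v , ε , pair₂) , proj₁ p , proj₁ p′ }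

  fold-compat : ∀ {τ} {t s : Tm (unf τ)} → L⁺ _ t s → L⁺ (μ τ) (fold t) (fold s)
  fold-compat {s = s} p = value-compat tt (fold (lower p))
    λ { _ fold-l → s , (fold s , ε , fold-l) , proj₁ p }

  app-compat : ∀ {τ₁ τ₂} {t s : Tm (τ₁ ⇒ τ₂)} {u v : Tm τ₁} →
               L⁺ _ t s → L⁺ _ u v → L⁺ _ (t · u) (s · v)
  app-compat {τ₂ = τ₂} {v = v} p p′ = nonvalue-compat τ₂ (λ ()) (lower p · lower p′) 𝓔-app
    where
    𝓔-app : 𝓔 L _ _ _
    𝓔-app _ (app-l d) with 𝓔-part p _ d
    ... | s′ , steps , r = s′ · v , gmap (_· v) app-l steps , 𝓛ⁿ-compatible (base r · lower p′)
    𝓔-app t′ (app-β d) with 𝓥-part p _ _ t′ (proj₁ p′) d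
    ... | s′ , weak , r = s′ , ⟹-eliminate (_· v) app-l app-β weak , r

  case-compat : ∀ {τ₁ τ₂ τ₃} {t s : Tm (τ₁ ⊞ τ₂)} {f f′ : Tm (τ₁ ⇒ τ₃)} {g g′ : Tm (τ₂ ⇒ τ₃)} →
                L⁺ _ t s → L⁺ _ f f′ → L⁺ _ g g′ → L⁺ _ (case t f g) (case s f′ g′)
  case-compat {τ₃ = τ₃} {f′ = f′} {g′ = g′} p pf pg =
    nonvalue-compat τ₃ (λ ()) (case (lower p) (lower pf) (lower pg)) 𝓔-case
    where
    𝓔-case : 𝓔 L _ _ _
    𝓔-case _ (case-c d) with 𝓔-part p _ d
    ... | s′ , steps , r = case s′ f′ g′ , gmap (λ x → case x f′ g′) case-c steps
                         , 𝓛ⁿ-compatible (case (base r) (lower pf) (lower pg))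
    𝓔-case _ (case-₁ d) with proj₁ (𝓥-part p) _ d
    ... | s′ , weak , r = f′ · s′ , ⟹-eliminate (λ x → case x f′ g′) case-c case-₁ weak
                        , 𝓛ⁿ-compatible (lower pf · base r)
    𝓔-case _ (case-₂ d) with proj₂ (𝓥-part p) _ d
    ... | s′ , weak , r = g′ · s′ , ⟹-eliminate (λ x → case x f′ g′) case-c case-₂ weak
                        , 𝓛ⁿ-compatible (lower pg · base r)

  fst-compat : ∀ {τ₁ τ₂} {t s : Tm (τ₁ ⊠ τ₂)} → L⁺ _ t s → L⁺ _ (fst t) (fst s)
  fst-compat {τ₁ = τ₁} p = nonvalue-compat τ₁ (λ ()) (fst (lower p)) 𝓔-fst
    where
    𝓔-fst : 𝓔 L _ _ _
    𝓔-fst _ (fst-c d) with 𝓔-part p _ d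
    ... | s′ , steps , r = fst s′ , gmap fst fst-c steps , 𝓛ⁿ-compatible (fst (base r))
    𝓔-fst _ (fst-β d) with 𝓥-part p _ _ d (proj₂ (l⊠₁⇒l⊠₂ d))
    ... | s₁ , _ , weak , _ , r , _ = s₁ , ⟹-eliminate fst fst-c fst-β weak , r

  snd-compat : ∀ {τ₁ τ₂} {t s : Tm (τ₁ ⊠ τ₂)} → L⁺ _ t s → L⁺ _ (snd t) (snd s)
  snd-compat {τ₂ = τ₂} p = nonvalue-compat τ₂ (λ ()) (snd (lower p)) 𝓔-snd
    where
    𝓔-snd : 𝓔 L _ _ _
    𝓔-snd _ (snd-c d) with 𝓔-part p _ d
    ... | s′ , steps , r = snd s′ , gmap snd snd-c steps , 𝓛ⁿ-compatible (snd (base r))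
    𝓔-snd _ (snd-β d) with 𝓥-part p _ _ (proj₂ (l⊠₂⇒l⊠₁ d)) d
    ... | _ , s₂ , _ , weak , _ , r = s₂ , ⟹-eliminate snd snd-c snd-β weak , r

  unfold-compat : ∀ {τ} {t s : Tm (μ τ)} → L⁺ _ t s → L⁺ (unf τ) (unfold t) (unfold s)
  unfold-compat {τ} p = nonvalue-compat (unf τ) (λ ()) (unfold (lower p)) 𝓔-unfold
    where
    𝓔-unfold : 𝓔 L _ _ _
    𝓔-unfold _ (unfold-c d) with 𝓔-part p _ d
    ... | s′ , steps , r = unfold s′ , gmap unfold unfold-c steps , 𝓛ⁿ-compatible (unfold (base r))
    𝓔-unfold _ (unfold-β d) with 𝓥-part p _ d
    ... | s′ , weak , r = s′ , ⟹-eliminate unfold unfold-c unfold-β weak , r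

  𝓛ⁿ⁺¹-compatible : ∀ {τ t s} → Compatible L⁺ τ t s → L⁺ τ t s
  𝓛ⁿ⁺¹-compatible (base p)     = p
  𝓛ⁿ⁺¹-compatible S            = S-compat
  𝓛ⁿ⁺¹-compatible K            = K-compat
  𝓛ⁿ⁺¹-compatible I            = I-compat
  𝓛ⁿ⁺¹-compatible (S′ c)       = S′-compat (𝓛ⁿ⁺¹-compatible c)
  𝓛ⁿ⁺¹-compatible (S″ c c′)    = S″-compat (𝓛ⁿ⁺¹-compatible c) (𝓛ⁿ⁺¹-compatible c′)
  𝓛ⁿ⁺¹-compatible (K′ c)       = K′-compat (𝓛ⁿ⁺¹-compatible c)
  𝓛ⁿ⁺¹-compatible (c · c′)     = app-compat (𝓛ⁿ⁺¹-compatible c) (𝓛ⁿ⁺¹-compatible c′)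
  𝓛ⁿ⁺¹-compatible (inl c)      = inl-compat (𝓛ⁿ⁺¹-compatible c)
  𝓛ⁿ⁺¹-compatible (inr c)      = inr-compat (𝓛ⁿ⁺¹-compatible c)
  𝓛ⁿ⁺¹-compatible (case c f g) =
    case-compat (𝓛ⁿ⁺¹-compatible c) (𝓛ⁿ⁺¹-compatible f) (𝓛ⁿ⁺¹-compatible g)
  𝓛ⁿ⁺¹-compatible (pair c c′)  = pair-compat (𝓛ⁿ⁺¹-compatible c) (𝓛ⁿ⁺¹-compatible c′)
  𝓛ⁿ⁺¹-compatible (fst c)      = fst-compat (𝓛ⁿ⁺¹-compatible c)
  𝓛ⁿ⁺¹-compatible (snd c)      = snd-compat (𝓛ⁿ⁺¹-compatible c)
  𝓛ⁿ⁺¹-compatible (fold c)     = fold-compat (𝓛ⁿ⁺¹-compatible c)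
  𝓛ⁿ⁺¹-compatible (unfold c)   = unfold-compat (𝓛ⁿ⁺¹-compatible c)

𝓛-compatible : ∀ n {τ t s} → Compatible (𝓛 n) τ t s → 𝓛 n τ t s
𝓛-compatible zero    _ = tt
𝓛-compatible (suc n)   = SuccessorLevel.𝓛ⁿ⁺¹-compatible n (𝓛-compatible n)

corollary3p5 : (τ : CTy) (t : Tm τ) → 𝓛ω τ t t
corollary3p5 τ t n = 𝓛-compatible n (Compatible-refl t)
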